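{- Let $(T_n)_{n\ge 0}$ be the Tribonacci sequence. The Diophantine equation $$(T_{n}-1)(T_{n+1}-1)\cdots (T_{n+\ell-1}-1)=d\left(\frac{10^{m}-1}{9}\right)$$ has no solution in positive integers $n,\ell,m,d$ with $1\leq d\leq 9$ and $m\geq 2$.
   Context: The Tribonacci sequence is defined by $T_0=0$, $T_1=T_2=1$ and $T_{n+3}=T_{n+2}+T_{n+1}+T_n$ for all $n\ge 0$. The right-hand side $d(10^m-1)/9$ is the repdigit consisting of $m$ copies of the digit $d$. -}

module Defs where

open import Data.Nat using (ℕ; zero; suc; _+_; _*_; _∸_; _^_; _/_)

T : ℕ → ℕ
T 0 = 0
T 1 = 1
T 2 = 1
T (suc (suc (suc n))) = T (suc (suc n)) + T (suc n) + T n

-- (T n - 1)(T (n+1) - 1) ... (T (n+ℓ-1) - 1)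
-- (truncated subtraction is exact here since T k ≥ 1 for k ≥ 1, and n ≥ 1 in the theorem)
prodTm1 : ℕ → ℕ → ℕ
prodTm1 n zero = 1
prodTm1 n (suc ℓ) = (T n ∸ 1) * prodTm1 (suc n) ℓ

repdigit : ℕ → ℕ → ℕ
repdigit d m = d * ((10 ^ m ∸ 1) / 9)

{-# OPTIONS --safe #-}
-- With u k = T (k + 1) − 1, which satisfies u (k + 3) = u (k + 2) + u (k + 1) + u k + 2, the
-- left-hand side is a product of ℓ consecutive terms of u. Any seven consecutive terms have a
-- product divisible by 16 (u mod 16 has period 32), whereas d times a repunit is not, repunits
-- being odd; hence ℓ ≤ 6. For m = 2 the right-hand side is at most 99 while u k ≥ 148 for k ≥ 9,
-- leaving finitely many cases. For m ≥ 3 a sieve modulo M = 2³·5³·7·13·29·41·61·311 finishes: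
-- windows of three consecutive terms of u are periodic mod M with period 260400, repunits with at
-- least three digits are periodic mod M with period 13020, and no product of one to six
-- consecutive terms of u is congruent to a repdigit. The last three digits ddd of a repdigit and
-- the modulus M₁ = M / (29·311), where the repunit period is only 60, serve as cheap filters.
module Submission where

open import Defs
open import Data.Nat using (ℕ; _≤_; _≥_)
open import Relation.Binary.PropositionalEquality using (_≡_)
open import Relation.Nullary using (¬_)

open import Data.Bool as Bool using (Bool; true; not; _∧_; _∨_)
open import Data.Bool.Properties using (T-≡; T-∧; T-∨)
open import Data.Nat
  using (zero; suc; _+_; _*_; _∸_; _^_; _/_; _%_; _<_; _≤?_; _≡ᵇ_; z≤n; s≤s; NonZero; >-nonZero; ≢-nonZero⁻¹)
open import Data.Nat.Properties
  using (≡ᵇ⇒≡; ≡⇒≡ᵇ; +-comm; *-assoc; *-comm; m+n∸n≡m; ≤-refl; ≤-reflexive; ≤-trans; ≤-pred;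
         m≤n⇒m≤1+n; m≤n⇒m<n∨m≡n; m≤m+n; m≤m*n; *-mono-≤; *-monoˡ-≤; ≰⇒>; even≢odd; m*n≡0⇒m≡0)
open import Data.Nat.DivMod
  using (m≡m%n+[m/n]*n; m%n<n; m%n%n≡m%n; m*n%n≡0; m*n/n≡m; m<n⇒m%n≡m; %-distribˡ-+; %-distribˡ-*; m∣n⇒o%n%m≡o%m)
open import Data.Nat.Divisibility
  using (_∣_; _∤_; divides; 1∣_; ∣-trans; *-monoʳ-∣; *-cancelˡ-∣; m*n∣⇒m∣; m%n≡0⇒n∣m; >⇒∤)
open import Data.Nat.GeneralisedArithmetic using (iterate)
open import Data.Nat.Primality using (euclidsLemma; prime[2])
open import Data.Nat.Tactic.RingSolver using (solve-∀)
open import Data.Product using (_×_; _,_; proj₁; proj₂)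
open import Data.Sum using (inj₁; inj₂; [_,_]′)
open import Function using (_∘_; Equivalence)
open import Relation.Binary.PropositionalEquality
  using (_≢_; refl; sym; trans; cong; cong₂; subst; module ≡-Reasoning)
open import Relation.Nullary using (yes; no; contradiction)
open import Relation.Nullary.Decidable using (from-no)

open ≡-Reasoning
open Equivalence using (to; from)

module _ {A : Set} (f : A → A) where

  iterate-suc : ∀ x n → iterate f x (suc n) ≡ f (iterate f x n)
  iterate-suc x zero    = refl
  iterate-suc x (suc n) = iterate-suc (f x) n

  iterate-+ : ∀ x m n → iterate f x (m + n) ≡ iterate f (iterate f x m) n
  iterate-+ x zero    n = refl
  iterate-+ x (suc m) n = iterate-+ (f x) m n

  iterate-recurrence : (t : ℕ → A) → (∀ k → t (suc k) ≡ f (t k)) →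
                       ∀ k → t k ≡ iterate f (t 0) k
  iterate-recurrence t t-suc zero    = refl
  iterate-recurrence t t-suc (suc k) = begin
    t (suc k)               ≡⟨ t-suc k ⟩
    f (t k)                 ≡⟨ cong f (iterate-recurrence t t-suc k) ⟩
    f (iterate f (t 0) k)   ≡⟨ iterate-suc (t 0) k ⟨
    iterate f (t 0) (suc k) ∎

  module _ {x : A} {p : ℕ} (periodic : iterate f x p ≡ x) where

    iterate-*-period : ∀ q → iterate f x (q * p) ≡ x
    iterate-*-period zero    = refl
    iterate-*-period (suc q) = begin
      iterate f x (p + q * p)           ≡⟨ iterate-+ x p (q * p) ⟩
      iterate f (iterate f x p) (q * p) ≡⟨ cong (λ y → iterate f y (q * p)) periodic ⟩
      iterate f x (q * p)               ≡⟨ iterate-*-period q ⟩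
      x                                 ∎

    iterate-%-period : .{{_ : NonZero p}} → ∀ k → iterate f x k ≡ iterate f x (k % p)
    iterate-%-period k = begin
      iterate f x k                               ≡⟨ cong (iterate f x) (m≡m%n+[m/n]*n k p) ⟩
      iterate f x (k % p + k / p * p)             ≡⟨ cong (iterate f x) (+-comm (k % p) (k / p * p)) ⟩
      iterate f x (k / p * p + k % p)             ≡⟨ iterate-+ x (k / p * p) (k % p) ⟩
      iterate f (iterate f x (k / p * p)) (k % p)
        ≡⟨ cong (λ y → iterate f y (k % p)) (iterate-*-period (k / p)) ⟩
      iterate f x (k % p)                         ∎

allBelow : ℕ → (ℕ → Bool) → Bool
allBelow zero    P = true
allBelow (suc n) P = P 0 ∧ allBelow n (P ∘ suc)

allBelow-sound : ∀ n (P : ℕ → Bool) → Bool.T (allBelow n P) → ∀ {i} → i < n → Bool.T (P i)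
allBelow-sound (suc n) P check {zero}  _         = proj₁ (to T-∧ check)
allBelow-sound (suc n) P check {suc i} (s≤s i<n) =
  allBelow-sound n (P ∘ suc) (proj₂ (to T-∧ check)) i<n

allOrbit : {A : Set} → (A → Bool) → (A → A) → A → ℕ → Bool
allOrbit P f x zero    = true
allOrbit P f x (suc n) = P x ∧ allOrbit P f (f x) n

allOrbit-sound : {A : Set} (P : A → Bool) (f : A → A) (x : A) (n : ℕ) →
                 Bool.T (allOrbit P f x n) → ∀ {i} → i < n → Bool.T (P (iterate f x i))
allOrbit-sound P f x (suc n) check {zero}  _         = proj₁ (to T-∧ check)
allOrbit-sound P f x (suc n) check {suc i} (s≤s i<n) =
  allOrbit-sound P f (f x) n (proj₂ (to T-∧ check)) i<n

-- The check is taken as `≡ true`, not `Bool.T`: Agda normalises a `Bool.T` of a closed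
-- computation whenever it inspects that type.
allOrbit-periodic : {A : Set} (P : A → Bool) (f : A → A) (t : ℕ → A) →
                    (∀ k → t (suc k) ≡ f (t k)) → (p : ℕ) .{{_ : NonZero p}} → iterate f (t 0) p ≡ t 0 →
                    allOrbit P f (t 0) p ≡ true → ∀ k → Bool.T (P (t k))
allOrbit-periodic P f t t-suc p periodic check k =
  subst (Bool.T ∘ P) (sym t-orbit) (allOrbit-sound P f (t 0) p (from T-≡ check) (m%n<n k p))
  where
  t-orbit : t k ≡ iterate f (t 0) (k % p)
  t-orbit = trans (iterate-recurrence f t t-suc k) (iterate-%-period f periodic k)

≢ᵇ⇒≢ : ∀ m n → Bool.T (not (m ≡ᵇ n)) → m ≢ n
≢ᵇ⇒≢ m n m≢ᵇn m≡n = subst (Bool.T ∘ not) (to T-≡ (≡⇒≡ᵇ m n m≡n)) m≢ᵇn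

module _ (Q : ℕ) .{{_ : NonZero Q}} where

  %-cong-+ : ∀ {a a′ b b′} → a % Q ≡ a′ % Q → b % Q ≡ b′ % Q → (a + b) % Q ≡ (a′ + b′) % Q
  %-cong-+ {a} {a′} {b} {b′} a≡a′ b≡b′ = begin
    (a + b) % Q             ≡⟨ %-distribˡ-+ a b Q ⟩
    (a % Q + b % Q) % Q     ≡⟨ cong₂ (λ x y → (x + y) % Q) a≡a′ b≡b′ ⟩
    (a′ % Q + b′ % Q) % Q   ≡⟨ %-distribˡ-+ a′ b′ Q ⟨
    (a′ + b′) % Q           ∎

  %-cong-* : ∀ {a a′ b b′} → a % Q ≡ a′ % Q → b % Q ≡ b′ % Q → (a * b) % Q ≡ (a′ * b′) % Q
  %-cong-* {a} {a′} {b} {b′} a≡a′ b≡b′ = begin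
    (a * b) % Q             ≡⟨ %-distribˡ-* a b Q ⟩
    (a % Q * (b % Q)) % Q   ≡⟨ cong₂ (λ x y → (x * y) % Q) a≡a′ b≡b′ ⟩
    (a′ % Q * (b′ % Q)) % Q ≡⟨ %-distribˡ-* a′ b′ Q ⟨
    (a′ * b′) % Q           ∎

u : ℕ → ℕ
u 0 = 0
u 1 = 0
u 2 = 1
u (suc (suc (suc k))) = u (suc (suc k)) + u (suc k) + u k + 2

T-suc≡suc-u : ∀ k → T (suc k) ≡ suc (u k)
T-suc≡suc-u 0 = refl
T-suc≡suc-u 1 = refl
T-suc≡suc-u 2 = refl
T-suc≡suc-u (suc (suc (suc k))) = begin
  T (3 + k) + T (2 + k) + T (1 + k)
    ≡⟨ cong₂ _+_ (cong₂ _+_ (T-suc≡suc-u (suc (suc k))) (T-suc≡suc-u (suc k))) (T-suc≡suc-u k) ⟩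
  suc (u (2 + k)) + suc (u (1 + k)) + suc (u k) ≡⟨ lemma (u (2 + k)) (u (1 + k)) (u k) ⟩
  suc (u (2 + k) + u (1 + k) + u k + 2)         ∎
  where
  lemma : ∀ a b c → suc a + suc b + suc c ≡ suc (a + b + c + 2)
  lemma = solve-∀

∏u : ℕ → ℕ → ℕ
∏u k zero    = 1
∏u k (suc l) = u k * ∏u (suc k) l

prodTm1≡∏u : ∀ k l → prodTm1 (suc k) l ≡ ∏u k l
prodTm1≡∏u k zero    = refl
prodTm1≡∏u k (suc l) = cong₂ _*_ (cong (_∸ 1) (T-suc≡suc-u k)) (prodTm1≡∏u (suc k) l)

∏u-∣ : ∀ k {a b} → a ≤ b → ∏u k a ∣ ∏u k b
∏u-∣ k {b = b} z≤n       = 1∣ ∏u k b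
∏u-∣ k         (s≤s a≤b) = *-monoʳ-∣ (u k) (∏u-∣ (suc k) a≤b)

u-≤-suc : ∀ k → u k ≤ u (suc k)
u-≤-suc 0 = z≤n
u-≤-suc 1 = z≤n
u-≤-suc (suc (suc k)) = ≤-trans (m≤m+n a b) (≤-trans (m≤m+n (a + b) c) (m≤m+n (a + b + c) 2))
  where a = u (suc (suc k)); b = u (suc k); c = u k

u-mono : ∀ {j k} → j ≤ k → u j ≤ u k
u-mono {k = zero}  z≤n   = ≤-refl
u-mono {k = suc k} j≤1+k with m≤n⇒m<n∨m≡n j≤1+k
... | inj₁ j<1+k = ≤-trans (u-mono (≤-pred j<1+k)) (u-≤-suc k)
... | inj₂ refl  = ≤-refl

∏u-pos : ∀ {k} → 2 ≤ k → ∀ l → 1 ≤ ∏u k l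
∏u-pos 2≤k zero    = ≤-refl
∏u-pos 2≤k (suc l) = *-mono-≤ (u-mono 2≤k) (∏u-pos (m≤n⇒m≤1+n 2≤k) l)

u-≤-∏u : ∀ {k} → 2 ≤ k → ∀ l → u k ≤ ∏u k (suc l)
u-≤-∏u {k} 2≤k l = m≤m*n (u k) (∏u (suc k) l) {{>-nonZero (∏u-pos (m≤n⇒m≤1+n 2≤k) l)}}

Triple : Set
Triple = ℕ × ℕ × ℕ

module _ (Q : ℕ) .{{_ : NonZero Q}} where

  windowMod : ℕ → Triple
  windowMod k = u k % Q , u (suc k) % Q , u (suc (suc k)) % Q

  stepMod : Triple → Triple
  stepMod (a , b , c) = b , c , (c + b + a + 2) % Q

  prodMod : Triple → ℕ → ℕ
  prodMod s           zero    = 1 % Q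
  prodMod s@(a , _ ) (suc l) = (a * prodMod (stepMod s) l) % Q

  windowMod-suc : ∀ k → windowMod (suc k) ≡ stepMod (windowMod k)
  windowMod-suc k = cong (λ c → u (suc k) % Q , u (suc (suc k)) % Q , c)
    (%-cong-+ Q (%-cong-+ Q (%-cong-+ Q (reduce (u (suc (suc k)))) (reduce (u (suc k)))) (reduce (u k))) refl)
    where
    reduce : ∀ a → a % Q ≡ a % Q % Q
    reduce a = sym (m%n%n≡m%n a Q)

  ∏u-% : ∀ k l → ∏u k l % Q ≡ prodMod (windowMod k) l
  ∏u-% k zero    = refl
  ∏u-% k (suc l) = begin
    (u k * ∏u (suc k) l) % Q                      ≡⟨ %-distribˡ-* (u k) (∏u (suc k) l) Q ⟩
    (u k % Q * (∏u (suc k) l % Q)) % Q            ≡⟨ cong (λ x → (u k % Q * x) % Q) (∏u-% (suc k) l) ⟩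
    (u k % Q * prodMod (windowMod (suc k)) l) % Q ≡⟨ cong (λ s → (u k % Q * prodMod s l) % Q) (windowMod-suc k) ⟩
    prodMod (windowMod k) (suc l)                 ∎

  windowMod-allOrbit : (P : Triple → Bool) (p : ℕ) .{{_ : NonZero p}} →
                       iterate stepMod (windowMod 0) p ≡ windowMod 0 →
                       allOrbit P stepMod (windowMod 0) p ≡ true → ∀ k → Bool.T (P (windowMod k))
  windowMod-allOrbit P = allOrbit-periodic P stepMod windowMod windowMod-suc

16∣∏u₇ : ∀ k → 16 ∣ ∏u k 7
16∣∏u₇ k = m%n≡0⇒n∣m (∏u k 7) 16
  (trans (∏u-% 16 k 7) (≡ᵇ⇒≡ _ 0 (windowMod-allOrbit 16 P 32 refl refl k)))
  where
  P : Triple → Bool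
  P s = prodMod 16 s 7 ≡ᵇ 0

repunit : ℕ → ℕ
repunit zero    = 0
repunit (suc m) = 10 * repunit m + 1

10^m≡9*repunit+1 : ∀ m → 10 ^ m ≡ 9 * repunit m + 1
10^m≡9*repunit+1 zero    = refl
10^m≡9*repunit+1 (suc m) = trans (cong (10 *_) (10^m≡9*repunit+1 m)) (lemma (repunit m))
  where
  lemma : ∀ r → 10 * (9 * r + 1) ≡ 9 * (10 * r + 1) + 1
  lemma = solve-∀

repdigit≡d*repunit : ∀ d m → repdigit d m ≡ d * repunit m
repdigit≡d*repunit d m = cong (d *_) (begin
  (10 ^ m ∸ 1) / 9           ≡⟨ cong (λ x → (x ∸ 1) / 9) (10^m≡9*repunit+1 m) ⟩
  (9 * repunit m + 1 ∸ 1) / 9 ≡⟨ cong (_/ 9) (trans (m+n∸n≡m (9 * repunit m) 1) (*-comm 9 (repunit m))) ⟩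
  (repunit m * 9) / 9        ≡⟨ m*n/n≡m (repunit m) 9 ⟩
  repunit m                  ∎)

repunit-odd : ∀ m → repunit (suc m) ≡ suc (2 * (5 * repunit m))
repunit-odd m = trans (+-comm (10 * repunit m) 1) (cong suc (*-assoc 2 5 (repunit m)))

2^e∣n*odd⇒2^e∣n : ∀ e n q → 2 ^ e ∣ n * suc (2 * q) → 2 ^ e ∣ n
2^e∣n*odd⇒2^e∣n zero    n q _ = 1∣ n
2^e∣n*odd⇒2^e∣n (suc e) n q 2^[1+e]∣n*o
  with euclidsLemma n (suc (2 * q)) prime[2] (m*n∣⇒m∣ 2 (2 ^ e) 2^[1+e]∣n*o)
... | inj₂ (divides k o≡k*2) = contradiction (trans (*-comm 2 k) (sym o≡k*2)) (even≢odd k q)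
... | inj₁ (divides n′ refl) =
  subst (2 ^ suc e ∣_) (*-comm 2 n′) (*-monoʳ-∣ 2 (2^e∣n*odd⇒2^e∣n e n′ q 2^e∣n′*o))
  where
  2^e∣n′*o : 2 ^ e ∣ n′ * suc (2 * q)
  2^e∣n′*o = *-cancelˡ-∣ 2 (subst (2 ^ suc e ∣_) (lemma n′ (suc (2 * q))) 2^[1+e]∣n*o)
    where
    lemma : ∀ a b → a * 2 * b ≡ 2 * (a * b)
    lemma = solve-∀

16∤d*repunit : ∀ {d} m → 1 ≤ d → d ≤ 9 → 16 ∤ d * repunit (suc m)
16∤d*repunit {d} m 1≤d d≤9 16∣d*r =
  >⇒∤ {{>-nonZero 1≤d}} (s≤s (≤-trans d≤9 (m≤m+n 9 6)))
    (2^e∣n*odd⇒2^e∣n 4 d (5 * repunit m) (subst (λ r → 16 ∣ d * r) (repunit-odd m) 16∣d*r))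

module _ (Q : ℕ) .{{_ : NonZero Q}} where

  repunitStepMod : ℕ → ℕ
  repunitStepMod r = (10 * r + 1) % Q

  repunit-suc-% : ∀ m → repunit (suc m) % Q ≡ repunitStepMod (repunit m % Q)
  repunit-suc-% m = %-cong-+ Q {b = 1} (%-cong-* Q {a = 10} refl (sym (m%n%n≡m%n (repunit m) Q))) refl

  module _ (p : ℕ) .{{_ : NonZero p}} where

    avoidsRepdigits : ℕ → ℕ → Bool
    avoidsRepdigits d v = allOrbit (λ r → not (v % Q ≡ᵇ (d * r) % Q)) repunitStepMod (repunit 3 % Q) p

    avoidsRepdigits-sound : iterate repunitStepMod (repunit 3 % Q) p ≡ repunit 3 % Q →
                            ∀ j {d v} → Bool.T (avoidsRepdigits d v) → v % Q ≢ (d * repunit (3 + j)) % Q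
    avoidsRepdigits-sound periodic j {d} {v} check v≡d*r = ≢ᵇ⇒≢ _ _ avoided (begin
      v % Q                           ≡⟨ v≡d*r ⟩
      (d * repunit (3 + j)) % Q       ≡⟨ %-cong-* Q {a = d} refl (sym (m%n%n≡m%n (repunit (3 + j)) Q)) ⟩
      (d * (repunit (3 + j) % Q)) % Q ∎)
      where
      avoided : Bool.T (not (v % Q ≡ᵇ (d * (repunit (3 + j) % Q)) % Q))
      avoided = allOrbit-periodic (λ r → not (v % Q ≡ᵇ (d * r) % Q)) repunitStepMod
        (λ i → repunit (3 + i) % Q) (λ i → repunit-suc-% (3 + i)) p periodic (to T-≡ check) j

M₁ M : ℕ
M₁ = 227591000
M  = 2052643229000

excludesRepdigit : ℕ → ℕ → Bool
excludesRepdigit d v = avoidsRepdigits M₁ 60 d v ∨ avoidsRepdigits M 13020 d v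

-- Here and below, the Booleans split by T-∨ are given explicitly: inferring them makes Agda
-- unfold the repunit orbits.
excludesRepdigit-sound : ∀ j {d v} → Bool.T (excludesRepdigit d v) → v ≢ (d * repunit (3 + j)) % M
excludesRepdigit-sound j {d} {v} check v≡d*r =
  [ (λ c → avoidsRepdigits-sound M₁ 60 refl j {d} {v} c (reduce (divides 9019 refl)))
  , (λ c → avoidsRepdigits-sound M 13020 refl j {d} {v} c (reduce (divides 1 refl)))
  ]′ (to (T-∨ {avoidsRepdigits M₁ 60 d v} {avoidsRepdigits M 13020 d v}) check)
  where
  reduce : ∀ {Q} .{{_ : NonZero Q}} → Q ∣ M → v % Q ≡ (d * repunit (3 + j)) % Q
  reduce {Q} Q∣M = trans (cong (_% Q) v≡d*r) (m∣n⇒o%n%m≡o%m Q M (d * repunit (3 + j)) Q∣M)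

repunit-%-1000 : ∀ j → repunit (3 + j) % 1000 ≡ 111
repunit-%-1000 zero    = refl
repunit-%-1000 (suc j) = trans (repunit-suc-% 1000 (3 + j)) (cong (repunitStepMod 1000) (repunit-%-1000 j))

repdigit-%-1000 : ∀ j {d} → d ≤ 9 → (d * repunit (3 + j)) % M % 1000 ≡ d * 111
repdigit-%-1000 j {d} d≤9 = begin
  (d * repunit (3 + j)) % M % 1000 ≡⟨ m∣n⇒o%n%m≡o%m 1000 M (d * repunit (3 + j)) (divides 2052643229 refl) ⟩
  (d * repunit (3 + j)) % 1000     ≡⟨ %-cong-* 1000 {a = d} {d} {b′ = 111} refl (repunit-%-1000 j) ⟩
  (d * 111) % 1000                 ≡⟨ m<n⇒m%n≡m (s≤s (*-monoˡ-≤ 111 d≤9)) ⟩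
  d * 111                          ∎

-- The last three digits of d * repunit m (m ≥ 3) are ddd, which leaves a single candidate digit.
notRepdigitMod : ℕ → Bool
notRepdigitMod v = not (v % 1000 % 111 ≡ᵇ 0) ∨ (v % 1000 ≡ᵇ 0) ∨ excludesRepdigit (v % 1000 / 111) v

notRepdigitMod-sound : ∀ j {d v} → 1 ≤ d → d ≤ 9 → Bool.T (notRepdigitMod v) → v ≢ (d * repunit (3 + j)) % M
notRepdigitMod-sound j {d} {v} 1≤d d≤9 check v≡d*r =
  [ (λ c → ≢ᵇ⇒≢ (v % 1000 % 111) 0 c (trans (cong (_% 111) v%1000≡d*111) (m*n%n≡0 d 111)))
  , [ (λ c → ≢-nonZero⁻¹ d {{>-nonZero 1≤d}}
               (m*n≡0⇒m≡0 d 111 (trans (sym v%1000≡d*111) (≡ᵇ⇒≡ (v % 1000) 0 c))))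
    , (λ c → excludesRepdigit-sound j {d} {v} (subst (λ e → Bool.T (excludesRepdigit e v)) digit≡d c) v≡d*r)
    ]′ ∘ to (T-∨ {v % 1000 ≡ᵇ 0} {excludesRepdigit (v % 1000 / 111) v})
  ]′ (to (T-∨ {not (v % 1000 % 111 ≡ᵇ 0)} {(v % 1000 ≡ᵇ 0) ∨ excludesRepdigit (v % 1000 / 111) v}) check)
  where
  v%1000≡d*111 : v % 1000 ≡ d * 111
  v%1000≡d*111 = trans (cong (_% 1000) v≡d*r) (repdigit-%-1000 j d≤9)
  digit≡d : v % 1000 / 111 ≡ d
  digit≡d = trans (cong (_/ 111) v%1000≡d*111) (m*n/n≡m d 111)

∏u≢d*repunit₂ : ∀ k l d → 1 ≤ l → l ≤ 6 → 1 ≤ d → d ≤ 9 → ∏u k l ≢ d * repunit 2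
∏u≢d*repunit₂ k (suc l′) (suc d′) _ l′<6 _ d′<9 with k ≤? 8
... | yes k≤8 = ≢ᵇ⇒≢ _ _
  (allBelow-sound 9 (P k l′) (allBelow-sound 6 (λ l → allBelow 9 (P k l))
    (allBelow-sound 9 (λ i → allBelow 6 λ l → allBelow 9 (P i l)) (from T-≡ small) (s≤s k≤8)) l′<6) d′<9)
  where
  P : ℕ → ℕ → ℕ → Bool
  P i l e = not (∏u i (suc l) ≡ᵇ suc e * repunit 2)
  small : allBelow 9 (λ i → allBelow 6 λ l → allBelow 9 (P i l)) ≡ true
  small = refl
... | no k≰8 = λ eq → from-no (148 ≤? 99)
  (≤-trans (u-mono 9≤k) (≤-trans (u-≤-∏u 2≤k l′) (≤-trans (≤-reflexive eq) (*-monoˡ-≤ 11 d′<9))))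
  where
  9≤k : 9 ≤ k
  9≤k = ≰⇒> k≰8
  2≤k : 2 ≤ k
  2≤k = ≤-trans (s≤s (s≤s z≤n)) 9≤k

shortProductsNotRepdigit : Triple → Bool
shortProductsNotRepdigit s = allBelow 6 (λ l′ → notRepdigitMod (prodMod M s (suc l′)))

sieve : allOrbit shortProductsNotRepdigit (stepMod M) (windowMod M 0) 260400 ≡ true
sieve = refl

∏u≢d*repunit₃ : ∀ k l j d → 1 ≤ l → l ≤ 6 → 1 ≤ d → d ≤ 9 → ∏u k l ≢ d * repunit (3 + j)
∏u≢d*repunit₃ k (suc l′) j d _ l′<6 1≤d d≤9 eq =
  notRepdigitMod-sound j {d} {prodMod M (windowMod M k) (suc l′)} 1≤d d≤9 check
    (trans (sym (∏u-% M k (suc l′))) (cong (_% M) eq))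
  where
  check : Bool.T (notRepdigitMod (prodMod M (windowMod M k) (suc l′)))
  check = allBelow-sound 6 (λ l′ → notRepdigitMod (prodMod M (windowMod M k) (suc l′)))
    (windowMod-allOrbit M shortProductsNotRepdigit 260400 refl sieve k) l′<6

∏u≢d*repunit : ∀ k l m d → 1 ≤ l → 2 ≤ m → 1 ≤ d → d ≤ 9 → ∏u k l ≢ d * repunit m
∏u≢d*repunit k l 1 d _ (s≤s ()) _ _
∏u≢d*repunit k l (suc (suc i)) d 1≤l _ 1≤d d≤9 with 7 ≤? l
... | yes 7≤l = λ eq →
  16∤d*repunit (suc i) 1≤d d≤9 (subst (16 ∣_) eq (∣-trans (16∣∏u₇ k) (∏u-∣ k 7≤l)))
... | no  l≱7 = short i
  where
  l≤6 : l ≤ 6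
  l≤6 = ≤-pred (≰⇒> l≱7)
  short : ∀ i → ∏u k l ≢ d * repunit (2 + i)
  short zero    = ∏u≢d*repunit₂ k l d 1≤l l≤6 1≤d d≤9
  short (suc j) = ∏u≢d*repunit₃ k l j d 1≤l l≤6 1≤d d≤9

theorem2 : (n ℓ m d : ℕ) → 1 ≤ n → 1 ≤ ℓ → m ≥ 2 → 1 ≤ d → d ≤ 9 →
    ¬ (prodTm1 n ℓ ≡ repdigit d m)
theorem2 (suc k) ℓ m d _ 1≤ℓ m≥2 1≤d d≤9 eq = ∏u≢d*repunit k ℓ m d 1≤ℓ m≥2 1≤d d≤9 (begin
  ∏u k ℓ            ≡⟨ prodTm1≡∏u k ℓ ⟨
  prodTm1 (suc k) ℓ ≡⟨ eq ⟩
  repdigit d m      ≡⟨ repdigit≡d*repunit d m ⟩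
  d * repunit m     ∎)
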